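{- Let $G$ be a finite group with identity $e$ and let $U\subseteq G\setminus\{e\}$ be symmetric. If $G$ has an element $x$ of order $2$ with $x\notin U$ and $xUx=U$, then there exist symmetric subsets $S,T\subseteq G\setminus\{e\}$ with $A(G;U)=A(G;S)A(G;T)$.
   Context: A subset $X$ is symmetric if $X^{ -1}=X$. Fix an enumeration $G=\{g_1,\dots,g_n\}$; for $X\subseteq G$, $A(G;X)$ is the $n\times n$ matrix with $(i,j)$ entry $1$ if $g_i^{ -1}g_j\in X$ and $0$ otherwise. -}

module Defs where

open import Level using (0ℓ)
open import Data.Nat using (ℕ; zero; suc; _+_; _*_)
open import Data.Fin using (Fin)
open import Data.Bool using (Bool; true; false; if_then_else_)
open import Data.Vec.Functional using (foldr)
open import Algebra.Bundles using (Group)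
open import Function.Bundles using (_↔_; Inverse)
open import Relation.Binary.PropositionalEquality using (_≡_)
open import Relation.Nullary using (¬_)

record FiniteGroup : Set₁ where
  field
    group : Group 0ℓ 0ℓ
  open Group group public
  field
    ≈-is-≡ : ∀ {a b} → a ≈ b → a ≡ b
    n      : ℕ
    enum   : Fin n ↔ Carrier

  g : Fin n → Carrier
  g = Inverse.to enum

module _ (G : FiniteGroup) where
  open FiniteGroup G

  Subset : Set
  Subset = Carrier → Bool

  infix 4 _∈_
  _∈_ : Carrier → Subset → Set
  a ∈ X = X a ≡ true

  Symmetric : Subset → Set
  Symmetric X = ∀ a → X (a ⁻¹) ≡ X a

  AvoidsIdentity : Subset → Set
  AvoidsIdentity X = ¬ (ε ∈ X)

  HasOrder2 : Carrier → Set
  HasOrder2 x = ¬ (x ≡ ε) × (x ∙ x ≡ ε)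
    where open import Data.Product using (_×_)

  ConjInvariant : Carrier → Subset → Set
  ConjInvariant x U = (∀ a → a ∈ U → ((x ∙ a) ∙ x) ∈ U) × (∀ a → a ∈ U → ∃ λ b → (b ∈ U) × ((x ∙ b) ∙ x ≡ a))
    where open import Data.Product using (_×_; ∃)

  Matrix : Set
  Matrix = Fin n → Fin n → ℕ

  cayleyMatrix : Subset → Matrix
  cayleyMatrix X i j = if X ((g i) ⁻¹ ∙ g j) then 1 else 0

  _⊗_ : Matrix → Matrix → Matrix
  (M ⊗ N) i j = foldr _+_ 0 (λ k → M i k * N k j)

{-# OPTIONS --safe #-}

-- Take S = {x} and T = xU.  Row g_i of A(G;{x}) M is row g_i x of M, so
-- A(G;{x}) A(G;X) = A(G;xX) for every X, and x(xU) = U because x² = e.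
-- T is symmetric since (xU)⁻¹ = U x = x (x U x) = xU, and e ∉ xU since x⁻¹ = x ∉ U.

module Submission where

open import Defs
open import Data.Bool.Base using (true; if_then_else_)
open import Data.Bool.Properties using (⇔→≡)
open import Data.Fin.Base using (Fin; punchIn)
open import Data.Fin.Properties using (punchInᵢ≢i) renaming (_≟_ to _≟ᶠ_)
open import Data.Nat.Base using (ℕ; suc; _+_; _*_)
open import Data.Nat.Properties using (+-0-commutativeMonoid; +-identityʳ; *-identityˡ)
open import Data.Product.Base using (Σ; _×_; _,_)
open import Data.Vec.Functional using (Vector; replicate; removeAt)
open import Function.Base using (_∘_; case_of_)
open import Function.Bundles using (Inverse; mk⇔)
open import Function.Properties.Inverse using (↔-sym; ↔⇒↣)
open import Relation.Binary.Definitions using (DecidableEquality)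
open import Relation.Binary.PropositionalEquality
  using (_≡_; _≢_; _≗_; refl; sym; trans; cong; cong₂; subst; module ≡-Reasoning)
open import Relation.Nullary using (¬_; does)
open import Relation.Nullary.Decidable using (via-injection; dec-true; dec-false; does-⇔)

open import Algebra.Properties.CommutativeMonoid.Sum +-0-commutativeMonoid
  using (sum; sum-remove; sum-cong-≗; sum-replicate-zero)

sum-single : ∀ {n} (t : Vector ℕ n) i → (∀ j → j ≢ i → t j ≡ 0) → sum t ≡ t i
sum-single {suc n} t i t-vanishes = begin
  sum t                      ≡⟨ sum-remove {i = i} t ⟩
  t i + sum (removeAt t i)   ≡⟨ cong (t i +_) (trans (sum-cong-≗ vanishes-off-i) (sum-replicate-zero n)) ⟩
  t i + 0                    ≡⟨ +-identityʳ (t i) ⟩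
  t i                        ∎
  where
  open ≡-Reasoning
  vanishes-off-i : removeAt t i ≗ replicate n 0
  vanishes-off-i j = t-vanishes (punchIn i j) (punchInᵢ≢i i j)

module CayleyMatrices (G : FiniteGroup) where
  open FiniteGroup G
    using (Carrier; _∙_; ε; _⁻¹; ≈-is-≡; n; enum; g; group; reflexive; assoc; identityʳ)
  open import Algebra.Properties.Group group
    using (\\-leftDividesˡ; \\-leftDividesʳ; ⁻¹-involutive; ⁻¹-anti-homo-∙; inverseʳ-unique; ∙-cancelˡ; ∙-cancelʳ)
  open ≡-Reasoning

  infix 4 _≟_
  _≟_ : DecidableEquality Carrier
  _≟_ = via-injection (↔⇒↣ (↔-sym enum)) _≟ᶠ_

  position : Carrier → Fin n
  position = Inverse.from enum

  g-position : ∀ a → g (position a) ≡ a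
  g-position = Inverse.strictlyInverseˡ enum

  position-unique : ∀ {a k} → g k ≡ a → k ≡ position a
  position-unique {k = k} refl = sym (Inverse.strictlyInverseʳ enum k)

  ｛_｝ : Carrier → Subset G
  ｛ y ｝ a = does (a ≟ y)

  infixr 7 _·_
  _·_ : Carrier → Subset G → Subset G
  (y · X) a = X (y ⁻¹ ∙ a)

  y∙y≡ε⇒y⁻¹≡y : ∀ {y} → y ∙ y ≡ ε → y ⁻¹ ≡ y
  y∙y≡ε⇒y⁻¹≡y {y} y∙y≡ε = sym (≈-is-≡ (inverseʳ-unique y y (reflexive y∙y≡ε)))

  ｛｝-symmetric : ∀ {y} → y ⁻¹ ≡ y → Symmetric G ｛ y ｝
  ｛｝-symmetric {y} y⁻¹≡y a = does-⇔ (mk⇔ to from) (a ⁻¹ ≟ y) (a ≟ y)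
    where
    to : a ⁻¹ ≡ y → a ≡ y
    to a⁻¹≡y = trans (sym (≈-is-≡ (⁻¹-involutive a))) (trans (cong _⁻¹ a⁻¹≡y) y⁻¹≡y)
    from : a ≡ y → a ⁻¹ ≡ y
    from refl = y⁻¹≡y

  ｛｝-avoidsIdentity : ∀ {y} → y ≢ ε → AvoidsIdentity G ｛ y ｝
  ｛｝-avoidsIdentity {y} y≢ε ε∈｛y｝ =
    case trans (sym (dec-false (ε ≟ y) (y≢ε ∘ sym))) ε∈｛y｝ of λ ()

  conjugation-invariant : ∀ {X y} → ConjInvariant G y X → ∀ a → X ((y ∙ a) ∙ y) ≡ X a
  conjugation-invariant {X} {y} (yXy⊆X , X⊆yXy) a = ⇔→≡ (mk⇔ reflect (yXy⊆X a))
    where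
    conjugation-injective : ∀ {b} → (y ∙ b) ∙ y ≡ (y ∙ a) ∙ y → b ≡ a
    conjugation-injective eq =
      ≈-is-≡ (∙-cancelˡ y _ _ (∙-cancelʳ y _ _ (reflexive eq)))
    reflect : _∈_ G ((y ∙ a) ∙ y) X → _∈_ G a X
    reflect yay∈X with X⊆yXy _ yay∈X
    ... | b , b∈X , yby≡yay = subst (λ c → _∈_ G c X) (conjugation-injective yby≡yay) b∈X

  ·-symmetric : ∀ {X y} → Symmetric G X → (∀ a → X ((y ∙ a) ∙ y) ≡ X a) → Symmetric G (y · X)
  ·-symmetric {X} {y} X-sym X-conj a = begin
    X (y ⁻¹ ∙ a ⁻¹)            ≡⟨ cong X (≈-is-≡ (⁻¹-anti-homo-∙ a y)) ⟨
    X ((a ∙ y) ⁻¹)             ≡⟨ X-sym (a ∙ y) ⟩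
    X (a ∙ y)                  ≡⟨ cong (λ b → X (b ∙ y)) (≈-is-≡ (\\-leftDividesˡ y a)) ⟨
    X ((y ∙ (y ⁻¹ ∙ a)) ∙ y)   ≡⟨ X-conj (y ⁻¹ ∙ a) ⟩
    X (y ⁻¹ ∙ a)               ∎

  ·-avoidsIdentity : ∀ {X y} → Symmetric G X → ¬ _∈_ G y X → AvoidsIdentity G (y · X)
  ·-avoidsIdentity {X} {y} X-sym y∉X ε∈yX = y∉X (begin
    X y             ≡⟨ X-sym y ⟨
    X (y ⁻¹)        ≡⟨ cong X (≈-is-≡ (identityʳ (y ⁻¹))) ⟨
    X (y ⁻¹ ∙ ε)    ≡⟨ ε∈yX ⟩
    true            ∎)

  ·-involutive : ∀ {X y} → y ∙ y ≡ ε → y · (y · X) ≗ X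
  ·-involutive {X} {y} y∙y≡ε a = cong X (begin
    y ⁻¹ ∙ (y ⁻¹ ∙ a)   ≡⟨ cong (λ z → y ⁻¹ ∙ (z ∙ a)) (y∙y≡ε⇒y⁻¹≡y y∙y≡ε) ⟩
    y ⁻¹ ∙ (y ∙ a)      ≡⟨ ≈-is-≡ (\\-leftDividesʳ y a) ⟩
    a                   ∎)

  cayleyMatrix-cong : ∀ {X Y} → X ≗ Y → ∀ i j → cayleyMatrix G X i j ≡ cayleyMatrix G Y i j
  cayleyMatrix-cong X≗Y i j = cong (if_then 1 else 0) (X≗Y _)

  cayleyMatrix-｛｝-⊗ : ∀ y X i j →
    _⊗_ G (cayleyMatrix G ｛ y ｝) (cayleyMatrix G X) i j ≡ cayleyMatrix G (y · X) i j
  cayleyMatrix-｛｝-⊗ y X i j = begin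
    sum (λ k → cayleyMatrix G ｛ y ｝ i k * cayleyMatrix G X k j)
      ≡⟨ sum-single _ k₀ (λ k k≢k₀ → cong (_* cayleyMatrix G X k j) (｛y｝-off-k₀ k k≢k₀)) ⟩
    cayleyMatrix G ｛ y ｝ i k₀ * cayleyMatrix G X k₀ j
      ≡⟨ cong₂ _*_ (cong (if_then 1 else 0) (dec-true (g i ⁻¹ ∙ g k₀ ≟ y) quotient-k₀))
                   (cong (λ a → if X a then 1 else 0) quotient-k₀-j) ⟩
    1 * cayleyMatrix G (y · X) i j
      ≡⟨ *-identityˡ _ ⟩
    cayleyMatrix G (y · X) i j ∎
    where
    k₀ : Fin n
    k₀ = position (g i ∙ y)

    quotient-k₀ : g i ⁻¹ ∙ g k₀ ≡ y
    quotient-k₀ = trans (cong (g i ⁻¹ ∙_) (g-position (g i ∙ y))) (≈-is-≡ (\\-leftDividesʳ (g i) y))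

    quotient-k₀-j : g k₀ ⁻¹ ∙ g j ≡ y ⁻¹ ∙ (g i ⁻¹ ∙ g j)
    quotient-k₀-j = begin
      g k₀ ⁻¹ ∙ g j              ≡⟨ cong (λ a → a ⁻¹ ∙ g j) (g-position (g i ∙ y)) ⟩
      (g i ∙ y) ⁻¹ ∙ g j         ≡⟨ cong (_∙ g j) (≈-is-≡ (⁻¹-anti-homo-∙ (g i) y)) ⟩
      (y ⁻¹ ∙ g i ⁻¹) ∙ g j      ≡⟨ ≈-is-≡ (assoc (y ⁻¹) (g i ⁻¹) (g j)) ⟩
      y ⁻¹ ∙ (g i ⁻¹ ∙ g j)      ∎

    ｛y｝-off-k₀ : ∀ k → k ≢ k₀ → cayleyMatrix G ｛ y ｝ i k ≡ 0
    ｛y｝-off-k₀ k k≢k₀ = cong (if_then 1 else 0) (dec-false (g i ⁻¹ ∙ g k ≟ y) (k≢k₀ ∘ k-unique))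
      where
      k-unique : g i ⁻¹ ∙ g k ≡ y → k ≡ k₀
      k-unique quotient≡y =
        position-unique (trans (sym (≈-is-≡ (\\-leftDividesˡ (g i) (g k)))) (cong (g i ∙_) quotient≡y))

mainTheorem8 : (G : FiniteGroup) → let open FiniteGroup G in
  (U : Subset G) → AvoidsIdentity G U → Symmetric G U →
  (x : Carrier) → HasOrder2 G x → ¬ (_∈_ G x U) → ConjInvariant G x U →
  Σ (Subset G) λ S → Σ (Subset G) λ T →
    (Symmetric G S × AvoidsIdentity G S) × (Symmetric G T × AvoidsIdentity G T) ×
    (∀ i j → cayleyMatrix G U i j ≡ _⊗_ G (cayleyMatrix G S) (cayleyMatrix G T) i j)
mainTheorem8 G U _ U-sym x (x≢ε , x∙x≡ε) x∉U x-conj =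
  ｛ x ｝ , x · U ,
  (｛｝-symmetric (y∙y≡ε⇒y⁻¹≡y x∙x≡ε) , ｛｝-avoidsIdentity x≢ε) ,
  (·-symmetric U-sym (conjugation-invariant x-conj) , ·-avoidsIdentity U-sym x∉U) ,
  λ i j → trans (cayleyMatrix-cong (sym ∘ ·-involutive {U} x∙x≡ε) i j)
                (sym (cayleyMatrix-｛｝-⊗ x (x · U) i j))
  where open CayleyMatrices G
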